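{- Let $G$ be a weakly connected directed multigraph having at least one Eulerian trail, with fixed source $v_0$, let $T^u$ be its uncompressed state tree, and let $s$ be a state of $T^u$. Then $s$ is branching if and only if the last node of $P_s$ has at least two outgoing multi-edges (to distinct nodes) that are not crossings in $G'_s$.
   Context: Source $v_0$: the unique node with $\mathrm{outdeg}(v)=\mathrm{indeg}(v)+1$ if it exists, otherwise an arbitrary fixed node. The multigraph is represented by multi-edges, each with a multiplicity (parallel copies merged); deleting an edge decreases the multiplicity by one, removing the multi-edge at multiplicity zero. $T^u$ is the rooted tree whose states are the prefixes of Eulerian trails starting at $v_0$ (distinguished by node sequence), the root being the empty prefix, with a transition from $s_1$ to $s_2$ if $P_{s_2}$ extends $P_{s_1}$ by one edge. The last node of $P_s$ is $v_0$ if empty, else the head of its last edge. $G'_s$ is obtained from $G$ by deleting the edges of $P_s$ and removing isolated nodes. A state is branching if it has at least two children. A crossing is a (multi-)edge whose endpoints lie in different strongly connected components. -}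

module Defs where

open import Data.Nat using (ℕ; zero; suc; _≤_; _<_; _∸_)
open import Data.Fin using (Fin)
open import Data.Fin.Properties using (_≟_)
open import Data.List using (List; []; _∷_; _++_; _∷ʳ_; map; allFin)
open import Data.Nat.ListAction using (sum)
open import Data.Product using (_×_; _,_; ∃; ∃-syntax; Σ-syntax)
open import Data.Sum using (_⊎_)
open import Relation.Nullary using (¬_; yes; no)
open import Relation.Binary.PropositionalEquality using (_≡_; _≢_)

-- A directed multigraph on node set Fin n, given by the multiplicity of each
-- multi-edge (u , v); multiplicity 0 means the multi-edge is absent.
-- Self-loops are allowed.
MultiGraph : ℕ → Set
MultiGraph n = Fin n → Fin n → ℕ

module _ {n : ℕ} where

  outdeg : MultiGraph n → Fin n → ℕ
  outdeg G v = sum (map (G v) (allFin n))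

  indeg : MultiGraph n → Fin n → ℕ
  indeg G v = sum (map (λ u → G u v) (allFin n))

  -- A walk is given by its start node u and the list of subsequent nodes.
  -- usesEdge u xs a b = number of times the walk traverses an edge a → b.
  usesEdge : Fin n → List (Fin n) → Fin n → Fin n → ℕ
  usesEdge u [] a b = 0
  usesEdge u (x ∷ xs) a b with u ≟ a | x ≟ b
  ... | yes _ | yes _ = suc (usesEdge x xs a b)
  ... | _     | _     = usesEdge x xs a b

  -- Eulerian trail starting at u: every edge copy used exactly once
  -- (in particular every consecutive pair of the walk is an edge).
  IsEulerianTrail : MultiGraph n → Fin n → List (Fin n) → Set
  IsEulerianTrail G u xs = ∀ a b → usesEdge u xs a b ≡ G a b

  HasEulerianTrail : MultiGraph n → Set
  HasEulerianTrail G = ∃[ u ] ∃[ xs ] IsEulerianTrail G u xs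

  -- Source: if some node has outdeg = indeg + 1, then v0 is that (unique) node;
  -- otherwise v0 is arbitrary.
  IsSource : MultiGraph n → Fin n → Set
  IsSource G v0 = ∀ v → outdeg G v ≡ suc (indeg G v) → v ≡ v0

  data UReach (G : MultiGraph n) : Fin n → Fin n → Set where
    here : ∀ {a} → UReach G a a
    step : ∀ {a c b} → (0 < G a c ⊎ 0 < G c a) → UReach G c b → UReach G a b

  WeaklyConnected : MultiGraph n → Set
  WeaklyConnected G = ∀ a b → UReach G a b

  -- States of T^u: prefixes (node sequences after v0) of Eulerian trails from v0.
  IsState : MultiGraph n → Fin n → List (Fin n) → Set
  IsState G v0 xs = ∃[ ys ] IsEulerianTrail G v0 (xs ++ ys)

  IsBranching : MultiGraph n → Fin n → List (Fin n) → Set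
  IsBranching G v0 xs =
    ∃[ x ] ∃[ y ] (x ≢ y × IsState G v0 (xs ∷ʳ x) × IsState G v0 (xs ∷ʳ y))

  lastNode : Fin n → List (Fin n) → Fin n
  lastNode v [] = v
  lastNode v (x ∷ xs) = lastNode x xs

  -- G'_s : G with the edges of P_s deleted (isolated nodes are irrelevant for
  -- reachability / strong components).
  remaining : MultiGraph n → Fin n → List (Fin n) → MultiGraph n
  remaining G v0 xs a b = G a b ∸ usesEdge v0 xs a b

  data Reach (H : MultiGraph n) : Fin n → Fin n → Set where
    here : ∀ {a} → Reach H a a
    step : ∀ {a c b} → 0 < H a c → Reach H c b → Reach H a b

  SameSCC : MultiGraph n → Fin n → Fin n → Set
  SameSCC H a b = Reach H a b × Reach H b a

  IsCrossing : MultiGraph n → Fin n → Fin n → Set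
  IsCrossing H a b = 0 < H a b × ¬ SameSCC H a b

  TwoNonCrossingOut : MultiGraph n → Fin n → List (Fin n) → Set
  TwoNonCrossingOut G v0 xs =
    let H = remaining G v0 xs ; u = lastNode v0 xs in
    ∃[ b₁ ] ∃[ b₂ ] (b₁ ≢ b₂ ×
      (0 < H u b₁ × ¬ IsCrossing H u b₁) ×
      (0 < H u b₂ × ¬ IsCrossing H u b₂))

{-# OPTIONS --safe #-}
-- After a state s the unused edges H = G'_s are exactly those of the
-- continuation, i.e. of an Eulerian trail of H from the last node u, so the
-- children of s are the first nodes of the Eulerian trails of H from u.
-- If two such trails start with distinct edges u → x and u → y, the edge
-- u → y lies on the trail from x, hence x reaches u and u → x is no crossing.
-- Conversely, if u → b is no crossing, write a trail through it as A ++ b ∷ B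
-- with A a closed walk at u.  A path from b back to u must enter the nodes of
-- A from the nodes of b ∷ B, so the two parts share a node z; rotating A to
-- start at z and splicing it into b ∷ B at z gives a trail starting with b.
module Submission where

open import Defs
open import Data.Nat using (ℕ; suc; _+_; _∸_; _<_; _≤_; z≤n; s≤s)
open import Data.Nat.Properties using (+-assoc; +-comm; m+n∸m≡n; m+[n∸m]≡n; m≤m+n; n≤1+n; ≤-trans)
open import Data.Fin using (Fin)
open import Data.Fin.Properties using (_≟_)
open import Data.List using (List; []; _∷_; _++_; _∷ʳ_; [_])
open import Data.List.Properties using (++-assoc)
open import Data.List.Relation.Unary.Any using (Any; here; there; any?)
open import Data.List.Membership.Propositional using (_∈_; find; lose)
open import Data.List.Membership.Propositional.Properties using (∈-∃++)
import Data.List.Membership.DecPropositional as DecMembership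
open import Data.Product using (_×_; _,_; ∃-syntax)
open import Data.Sum using (_⊎_; inj₁; inj₂)
open import Data.Empty using (⊥-elim)
open import Function using (_∘_)
open import Function.Bundles using (_⇔_; mk⇔; Equivalence)
open import Relation.Nullary using (¬_; yes; no)
open import Relation.Nullary.Decidable using (decidable-stable)
open import Relation.Binary.PropositionalEquality using (_≡_; _≢_; refl; sym; trans; cong; cong₂; subst; module ≡-Reasoning)
open ≡-Reasoning

module _ {n : ℕ} where
  open DecMembership (_≟_ {n}) using (_∈?_)

  private
    Walk = List (Fin n)

  IsClosedWalk : Fin n → Walk → Set
  IsClosedWalk u xs = lastNode u xs ≡ u

  _⊆ₑ_ : MultiGraph n → MultiGraph n → Set
  H ⊆ₑ H′ = ∀ {a b} → 0 < H a b → 0 < H′ a b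

  ≗⇒⊆ₑ : ∀ {H H′ : MultiGraph n} → (∀ a b → H a b ≡ H′ a b) → H ⊆ₑ H′
  ≗⇒⊆ₑ H≗H′ {a} {b} = subst (0 <_) (H≗H′ a b)

  Reach-mono : ∀ {H H′ : MultiGraph n} {a b} → H ⊆ₑ H′ → Reach H a b → Reach H′ a b
  Reach-mono H⊆H′ here       = here
  Reach-mono H⊆H′ (step e r) = step (H⊆H′ e) (Reach-mono H⊆H′ r)

  lastNode-++ : ∀ w (xs ys : Walk) → lastNode w (xs ++ ys) ≡ lastNode (lastNode w xs) ys
  lastNode-++ w []       ys = refl
  lastNode-++ w (x ∷ xs) ys = lastNode-++ x xs ys

  lastNode-∷ʳ : ∀ w (xs : Walk) z → lastNode w (xs ∷ʳ z) ≡ z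
  lastNode-∷ʳ w xs z = lastNode-++ w xs [ z ]

  usesEdge-++ : ∀ (w : Fin n) xs ys a b →
    usesEdge w (xs ++ ys) a b ≡ usesEdge w xs a b + usesEdge (lastNode w xs) ys a b
  usesEdge-++ w []       ys a b = refl
  usesEdge-++ w (x ∷ xs) ys a b with w ≟ a | x ≟ b
  ... | yes _ | yes _ = cong suc (usesEdge-++ x xs ys a b)
  ... | yes _ | no _  = usesEdge-++ x xs ys a b
  ... | no _  | _     = usesEdge-++ x xs ys a b

  usesEdge-++-∷ : ∀ (w : Fin n) xs z ys a b →
    usesEdge w (xs ++ z ∷ ys) a b ≡ usesEdge w (xs ∷ʳ z) a b + usesEdge z ys a b
  usesEdge-++-∷ w xs z ys a b = begin
    usesEdge w (xs ++ z ∷ ys) a b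
      ≡⟨ cong (λ l → usesEdge w l a b) (sym (++-assoc xs [ z ] ys)) ⟩
    usesEdge w ((xs ∷ʳ z) ++ ys) a b
      ≡⟨ usesEdge-++ w (xs ∷ʳ z) ys a b ⟩
    usesEdge w (xs ∷ʳ z) a b + usesEdge (lastNode w (xs ∷ʳ z)) ys a b
      ≡⟨ cong (λ v → usesEdge w (xs ∷ʳ z) a b + usesEdge v ys a b) (lastNode-∷ʳ w xs z) ⟩
    usesEdge w (xs ∷ʳ z) a b + usesEdge z ys a b ∎

  usesEdge-closed-++ : ∀ {w : Fin n} xs → IsClosedWalk w xs → ∀ ys a b →
    usesEdge w (xs ++ ys) a b ≡ usesEdge w xs a b + usesEdge w ys a b
  usesEdge-closed-++ {w} xs closed ys a b =
    trans (usesEdge-++ w xs ys a b) (cong (λ v → usesEdge w xs a b + usesEdge v ys a b) closed)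

  usesEdge-first : ∀ (w : Fin n) x xs → 0 < usesEdge w (x ∷ xs) w x
  usesEdge-first w x xs with w ≟ w | x ≟ x
  ... | yes _ | yes _  = s≤s z≤n
  ... | yes _ | no x≢x = ⊥-elim (x≢x refl)
  ... | no w≢w | _     = ⊥-elim (w≢w refl)

  usesEdge-∷-≢ : ∀ (w : Fin n) x xs a {y} → x ≢ y → usesEdge w (x ∷ xs) a y ≡ usesEdge x xs a y
  usesEdge-∷-≢ w x xs a {y} x≢y with w ≟ a | x ≟ y
  ... | yes _ | yes x≡y = ⊥-elim (x≢y x≡y)
  ... | yes _ | no _    = refl
  ... | no _  | _       = refl

  usesEdge-∷-mono : ∀ (w : Fin n) x xs → usesEdge x xs ⊆ₑ usesEdge w (x ∷ xs)
  usesEdge-∷-mono w x xs {a} {b} e with w ≟ a | x ≟ b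
  ... | yes _ | yes _ = ≤-trans e (n≤1+n _)
  ... | yes _ | no _  = e
  ... | no _  | _     = e

  usesEdge⇒source-reachable : ∀ (w : Fin n) xs {a b} → 0 < usesEdge w xs a b → Reach (usesEdge w xs) w a
  usesEdge⇒source-reachable w (x ∷ xs) {a} {b} e with w ≟ a | x ≟ b
  ... | yes refl | _ = here
  ... | no _     | _ = step (usesEdge-first w x xs)
                           (Reach-mono (usesEdge-∷-mono w x xs) (usesEdge⇒source-reachable x xs e))

  usesEdge⇒target∈ : ∀ (w : Fin n) xs {a b} → 0 < usesEdge w xs a b → b ∈ xs
  usesEdge⇒target∈ w (x ∷ xs) {a} {b} e with w ≟ a | x ≟ b
  ... | yes _ | yes refl = here refl
  ... | yes _ | no _     = there (usesEdge⇒target∈ x xs e)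
  ... | no _  | _        = there (usesEdge⇒target∈ x xs e)

  usesEdge-++⇒cut : ∀ (w : Fin n) xs ys {a b} → 0 < usesEdge w (xs ++ ys) a b → a ∈ w ∷ xs ⊎ b ∈ ys
  usesEdge-++⇒cut w []       ys e = inj₂ (usesEdge⇒target∈ w ys e)
  usesEdge-++⇒cut w (x ∷ xs) ys {a} {b} e with w ≟ a | x ≟ b
  ... | yes refl | _ = inj₁ (here refl)
  ... | no _     | _ with usesEdge-++⇒cut x xs ys e
  ...   | inj₁ a∈xs = inj₁ (there a∈xs)
  ...   | inj₂ b∈ys = inj₂ b∈ys

  usesEdge-split : ∀ (w : Fin n) xs {a b} → 0 < usesEdge w xs a b →
    ∃[ A ] ∃[ B ] (xs ≡ A ++ b ∷ B × lastNode w A ≡ a)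
  usesEdge-split w (x ∷ xs) {a} {b} e with w ≟ a | x ≟ b
  ... | yes w≡a | yes refl = [] , xs , refl , w≡a
  ... | yes _   | no _     with usesEdge-split x xs e
  ...   | A , B , refl , last = x ∷ A , B , refl , last
  usesEdge-split w (x ∷ xs) {a} {b} e | no _ | _ with usesEdge-split x xs e
  ...   | A , B , refl , last = x ∷ A , B , refl , last

  reach-meets : ∀ {H : MultiGraph n} {S T : Walk} {c d} →
    (∀ {a b} → 0 < H a b → a ∈ S ⊎ b ∈ T) → c ∈ T → Reach H c d → d ∈ S → Any (_∈ S) T
  reach-meets cut c∈T here d∈S = lose c∈T d∈S
  reach-meets {S = S} {c = c} cut c∈T (step e r) d∈S with c ∈? S | cut e
  ... | yes c∈S | _         = lose c∈T c∈S
  ... | no c∉S  | inj₁ c∈S  = ⊥-elim (c∉S c∈S)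
  ... | no _    | inj₂ c′∈T = reach-meets cut c′∈T r d∈S

  rotate : ∀ {u z : Fin n} {A} → IsClosedWalk u A → z ∈ u ∷ A →
    ∃[ R ] (IsClosedWalk z R × ∀ a b → usesEdge z R a b ≡ usesEdge u A a b)
  rotate {A = A} closed (here refl) = A , closed , λ _ _ → refl
  rotate {u} {z} closed (there z∈A) with ∈-∃++ z∈A
  ... | X , Y , refl = Y ++ (X ∷ʳ z) , closedR , count
    where
    Y-ends-at-u : lastNode z Y ≡ u
    Y-ends-at-u = trans (sym (lastNode-++ u X (z ∷ Y))) closed
    closedR : IsClosedWalk z (Y ++ (X ∷ʳ z))
    closedR = trans (lastNode-++ z Y (X ∷ʳ z)) (lastNode-∷ʳ _ X z)
    count : ∀ a b → usesEdge z (Y ++ (X ∷ʳ z)) a b ≡ usesEdge u (X ++ z ∷ Y) a b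
    count a b = begin
      usesEdge z (Y ++ (X ∷ʳ z)) a b
        ≡⟨ usesEdge-++ z Y (X ∷ʳ z) a b ⟩
      usesEdge z Y a b + usesEdge (lastNode z Y) (X ∷ʳ z) a b
        ≡⟨ cong (λ v → usesEdge z Y a b + usesEdge v (X ∷ʳ z) a b) Y-ends-at-u ⟩
      usesEdge z Y a b + usesEdge u (X ∷ʳ z) a b
        ≡⟨ +-comm (usesEdge z Y a b) _ ⟩
      usesEdge u (X ∷ʳ z) a b + usesEdge z Y a b
        ≡⟨ sym (usesEdge-++-∷ u X z Y a b) ⟩
      usesEdge u (X ++ z ∷ Y) a b ∎

  usesEdge-splice : ∀ (w : Fin n) C z R D → IsClosedWalk z R → ∀ a b →
    usesEdge w (C ++ z ∷ (R ++ D)) a b ≡ usesEdge w (C ++ z ∷ D) a b + usesEdge z R a b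
  usesEdge-splice w C z R D closed a b = begin
    usesEdge w (C ++ z ∷ (R ++ D)) a b   ≡⟨ usesEdge-++-∷ w C z (R ++ D) a b ⟩
    c + usesEdge z (R ++ D) a b          ≡⟨ cong (c +_) (usesEdge-closed-++ R closed D a b) ⟩
    c + (r + d)                          ≡⟨ cong (c +_) (+-comm r d) ⟩
    c + (d + r)                          ≡⟨ sym (+-assoc c d r) ⟩
    c + d + r                            ≡⟨ cong (_+ r) (sym (usesEdge-++-∷ w C z D a b)) ⟩
    usesEdge w (C ++ z ∷ D) a b + r      ∎
    where
    c = usesEdge w (C ∷ʳ z) a b
    r = usesEdge z R a b
    d = usesEdge z D a b

  ++-∷-head : ∀ (C : Walk) {z D b B} E → C ++ z ∷ D ≡ b ∷ B → ∃[ T ] (C ++ z ∷ E ≡ b ∷ T)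
  ++-∷-head []      E refl = E , refl
  ++-∷-head (c ∷ C) E refl = C ++ _ ∷ E , refl

  splice-closed-prefix : ∀ {u : Fin n} {A b B z} → IsClosedWalk u A → z ∈ b ∷ B → z ∈ u ∷ A →
    ∃[ zs ] (∀ p q → usesEdge u (b ∷ zs) p q ≡ usesEdge u (A ++ b ∷ B) p q)
  splice-closed-prefix {u} {A} {b} {B} {z} closedA z∈B z∈A
    with rotate closedA z∈A | ∈-∃++ z∈B
  ... | R , closedR , countR | C , D , b∷B≡C++z∷D
    with ++-∷-head C (R ++ D) (sym b∷B≡C++z∷D)
  ... | T , C++z∷R++D≡b∷T = T , λ p q → begin
    usesEdge u (b ∷ T) p q
      ≡⟨ cong (λ l → usesEdge u l p q) (sym C++z∷R++D≡b∷T) ⟩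
    usesEdge u (C ++ z ∷ (R ++ D)) p q
      ≡⟨ usesEdge-splice u C z R D closedR p q ⟩
    usesEdge u (C ++ z ∷ D) p q + usesEdge z R p q
      ≡⟨ cong₂ _+_ (cong (λ l → usesEdge u l p q) (sym b∷B≡C++z∷D)) (countR p q) ⟩
    usesEdge u (b ∷ B) p q + usesEdge u A p q
      ≡⟨ +-comm (usesEdge u (b ∷ B) p q) _ ⟩
    usesEdge u A p q + usesEdge u (b ∷ B) p q
      ≡⟨ sym (usesEdge-closed-++ A closedA (b ∷ B) p q) ⟩
    usesEdge u (A ++ b ∷ B) p q ∎

  closedPrefix-meets-rest : ∀ (u : Fin n) A b B → ¬ ¬ Reach (usesEdge u (A ++ b ∷ B)) b u →
    Any (_∈ u ∷ A) (b ∷ B)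
  closedPrefix-meets-rest u A b B ¬¬b⇝u = decidable-stable (any? (_∈? u ∷ A) (b ∷ B)) λ ¬meet →
    ¬¬b⇝u λ b⇝u → ¬meet (reach-meets (usesEdge-++⇒cut u A (b ∷ B)) (here refl) b⇝u (here refl))

  reroute : ∀ (u : Fin n) ys b → 0 < usesEdge u ys u b → ¬ ¬ Reach (usesEdge u ys) b u →
    ∃[ zs ] (∀ p q → usesEdge u (b ∷ zs) p q ≡ usesEdge u ys p q)
  reroute u ys b u→b ¬¬b⇝u with usesEdge-split u ys u→b
  ... | A , B , refl , closedA with find (closedPrefix-meets-rest u A b B ¬¬b⇝u)
  ... | z , z∈B , z∈A = splice-closed-prefix closedA z∈B z∈A

  remaining-trail⇔ : ∀ {G : MultiGraph n} {v} s {ys} → IsEulerianTrail G v (s ++ ys) → ∀ zs →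
    IsEulerianTrail G v (s ++ zs) ⇔ IsEulerianTrail (remaining G v s) (lastNode v s) zs
  remaining-trail⇔ {G} {v} s {ys} eul zs = mk⇔ to from
    where
    to : IsEulerianTrail G v (s ++ zs) → IsEulerianTrail (remaining G v s) (lastNode v s) zs
    to eul′ a b = sym (begin
      G a b ∸ usesEdge v s a b
        ≡⟨ cong (_∸ usesEdge v s a b) (sym (eul′ a b)) ⟩
      usesEdge v (s ++ zs) a b ∸ usesEdge v s a b
        ≡⟨ cong (_∸ usesEdge v s a b) (usesEdge-++ v s zs a b) ⟩
      usesEdge v s a b + usesEdge (lastNode v s) zs a b ∸ usesEdge v s a b
        ≡⟨ m+n∸m≡n (usesEdge v s a b) _ ⟩
      usesEdge (lastNode v s) zs a b ∎)
    prefix≤G : ∀ a b → usesEdge v s a b ≤ G a b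
    prefix≤G a b = subst (usesEdge v s a b ≤_) (trans (sym (usesEdge-++ v s ys a b)) (eul a b)) (m≤m+n _ _)
    from : IsEulerianTrail (remaining G v s) (lastNode v s) zs → IsEulerianTrail G v (s ++ zs)
    from trail a b = begin
      usesEdge v (s ++ zs) a b                          ≡⟨ usesEdge-++ v s zs a b ⟩
      usesEdge v s a b + usesEdge (lastNode v s) zs a b ≡⟨ cong (usesEdge v s a b +_) (trail a b) ⟩
      usesEdge v s a b + (G a b ∸ usesEdge v s a b)     ≡⟨ m+[n∸m]≡n (prefix≤G a b) ⟩
      G a b                                             ∎

  child⇔remaining-trail : ∀ {G : MultiGraph n} {v} s {ys} → IsEulerianTrail G v (s ++ ys) → ∀ x →
    IsState G v (s ∷ʳ x) ⇔ (∃[ zs ] IsEulerianTrail (remaining G v s) (lastNode v s) (x ∷ zs))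
  child⇔remaining-trail {G} {v} s eul x = mk⇔
    (λ (zs , e) → zs , Equivalence.to (remaining-trail⇔ s eul (x ∷ zs))
                         (subst (IsEulerianTrail G v) (++-assoc s [ x ] zs) e))
    (λ (zs , t) → zs , subst (IsEulerianTrail G v) (sym (++-assoc s [ x ] zs))
                         (Equivalence.from (remaining-trail⇔ s eul (x ∷ zs)) t))

  distinctFirstEdges⇒nonCrossing : ∀ {H : MultiGraph n} {u x y xs ys} →
    IsEulerianTrail H u (x ∷ xs) → IsEulerianTrail H u (y ∷ ys) → x ≢ y →
    0 < H u x × ¬ IsCrossing H u x
  distinctFirstEdges⇒nonCrossing {H} {u} {x} {y} {xs} {ys} trailˣ trailʸ x≢y =
    u→x , λ (_ , ¬scc) → ¬scc (step u→x here , x⇝u)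
    where
    u→x : 0 < H u x
    u→x = ≗⇒⊆ₑ trailˣ (usesEdge-first u x xs)
    u→y-after-x : 0 < usesEdge x xs u y
    u→y-after-x = subst (0 <_) (usesEdge-∷-≢ u x xs u x≢y)
      (≗⇒⊆ₑ (λ a b → sym (trailˣ a b)) (≗⇒⊆ₑ trailʸ (usesEdge-first u y ys)))
    x⇝u : Reach H x u
    x⇝u = Reach-mono (λ e → ≗⇒⊆ₑ trailˣ (usesEdge-∷-mono u x xs e))
      (usesEdge⇒source-reachable x xs u→y-after-x)

  nonCrossing⇒trail-starting-with : ∀ {H : MultiGraph n} {u b} ys → IsEulerianTrail H u ys →
    0 < H u b → ¬ IsCrossing H u b → ∃[ zs ] IsEulerianTrail H u (b ∷ zs)
  nonCrossing⇒trail-starting-with {H} {u} {b} ys trail u→b ¬crossing =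
    let zs , same = reroute u ys b (H⊆trail u→b) ¬¬b⇝u in zs , λ p q → trans (same p q) (trail p q)
    where
    H⊆trail : H ⊆ₑ usesEdge u ys
    H⊆trail = ≗⇒⊆ₑ (λ p q → sym (trail p q))
    ¬¬b⇝u : ¬ ¬ Reach (usesEdge u ys) b u
    ¬¬b⇝u ¬b⇝u = ¬crossing (u→b , λ (_ , b⇝u) → ¬b⇝u (Reach-mono H⊆trail b⇝u))

mainTheorem15 : (n : ℕ) (G : MultiGraph n) (v₀ : Fin n) →
    WeaklyConnected G → HasEulerianTrail G → IsSource G v₀ →
    (s : List (Fin n)) → IsState G v₀ s →
    (IsBranching G v₀ s ⇔ TwoNonCrossingOut G v₀ s)
mainTheorem15 n G v₀ _ _ _ s (ys , eul) = mk⇔ branching⇒twoNonCrossing twoNonCrossing⇒branching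
  where
  open Equivalence using (to; from)
  H : MultiGraph n
  H = remaining G v₀ s
  u : Fin n
  u = lastNode v₀ s

  child⇔ : ∀ x → IsState G v₀ (s ∷ʳ x) ⇔ (∃[ zs ] IsEulerianTrail H u (x ∷ zs))
  child⇔ = child⇔remaining-trail s eul

  branching⇒twoNonCrossing : IsBranching G v₀ s → TwoNonCrossingOut G v₀ s
  branching⇒twoNonCrossing (x , y , x≢y , x-child , y-child) =
    let _ , trailˣ = to (child⇔ x) x-child ; _ , trailʸ = to (child⇔ y) y-child in
    x , y , x≢y , distinctFirstEdges⇒nonCrossing trailˣ trailʸ x≢y
                , distinctFirstEdges⇒nonCrossing trailʸ trailˣ (x≢y ∘ sym)

  twoNonCrossing⇒branching : TwoNonCrossingOut G v₀ s → IsBranching G v₀ s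
  twoNonCrossing⇒branching (b₁ , b₂ , b₁≢b₂ , (u→b₁ , ¬c₁) , (u→b₂ , ¬c₂)) =
    b₁ , b₂ , b₁≢b₂ , from (child⇔ b₁) (nonCrossing⇒trail-starting-with ys trail u→b₁ ¬c₁)
                    , from (child⇔ b₂) (nonCrossing⇒trail-starting-with ys trail u→b₂ ¬c₂)
    where
    trail : IsEulerianTrail H u ys
    trail = to (remaining-trail⇔ s eul ys) eul
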